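{- For every finite simple undirected graph $G$, $\chi_o^+(G\,\square\,C_5)\le 15\,\chi_o^+(G)$, and $\chi_o^+(G\,\square\,C_k)\le 12\,\chi_o^+(G)$ for every integer $k\ge3$ with $k\neq5$.
   Context: $C_k$ is the undirected cycle on $k$ vertices. An oriented graph is a digraph with no loops, no multiple arcs and no pair of opposite arcs; an orientation of an undirected graph gives each edge one of its two directions. A homomorphism between oriented graphs is a vertex map sending arcs to arcs. The upper oriented chromatic number $\chi_o^+(G)$ is the smallest order of an oriented graph $\vec T$ such that every orientation of $G$ admits a homomorphism to $\vec T$. The Cartesian product $G\,\square\,H$ has vertex set $V(G)\times V(H)$, and $\{[u,v],[u',v']\}$ is an edge iff either $u=u'$ and $\{v,v'\}\in E(H)$, or $v=v'$ and $\{u,u'\}\in E(G)$. -}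

module Defs where

open import Level using (0ℓ)
open import Data.Nat using (ℕ; suc; _%_; _≤_; _<_)
open import Data.Fin using (Fin; toℕ)
open import Data.Product using (_×_; _,_; Σ; ∃)
open import Data.Sum using (_⊎_)
open import Relation.Nullary using (¬_)
open import Data.Empty using (⊥)
open import Relation.Binary.PropositionalEquality using (_≡_)

Graph : Set → Set₁
Graph V = V → V → Set

record IsSimple {V : Set} (E : Graph V) : Set where
  field
    sym     : ∀ {u v} → E u v → E v u
    irrefl  : ∀ {u} → ¬ E u u

Digraph : Set → Set₁
Digraph V = V → V → Set

-- Oriented graph: no loops, no pair of opposite arcs
-- (no multiple arcs is automatic for an arc relation).
record IsOriented {V : Set} (A : Digraph V) : Set where
  field
    loopless : ∀ {u} → ¬ A u u
    asym     : ∀ {u v} → A u v → ¬ A v u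

record IsOrientationOf {V : Set} (E : Graph V) (O : Digraph V) : Set where
  field
    arc⇒edge : ∀ {u v} → O u v → E u v
    edge⇒arc : ∀ {u v} → E u v → O u v ⊎ O v u
    oneDir   : ∀ {u v} → O u v → ¬ O v u

IsHom : {V W : Set} → Digraph V → Digraph W → (V → W) → Set
IsHom {V} O A f = ∀ {u v : V} → O u v → A (f u) (f v)

-- χ_o^+(E) ≤ m : there is an oriented graph T of order m (on Fin m)
-- such that every orientation of E admits a homomorphism to T.
UpperOColorable : {V : Set} → Graph V → ℕ → Set₁
UpperOColorable {V} E m =
  Σ (Digraph (Fin m)) λ T → IsOriented T ×
    (∀ (O : Digraph V) → IsOrientationOf E O → ∃ λ (f : V → Fin m) → IsHom O T f)

IsUpperOChromatic : {V : Set} → Graph V → ℕ → Set₁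
IsUpperOChromatic E m = UpperOColorable E m × (∀ j → j < m → ¬ UpperOColorable E j)

-- Cycle C_k on Fin k : i ~ j iff j ≡ i+1 (mod k) or i ≡ j+1 (mod k).
-- (For k = 0 the vertex set Fin 0 is empty, so the relation is irrelevant.)
Cycle : (k : ℕ) → Graph (Fin k)
Cycle ℕ.zero    i j = ⊥
Cycle (suc k') i j =
  (toℕ j ≡ suc (toℕ i) % suc k') ⊎ (toℕ i ≡ suc (toℕ j) % suc k')

_□_ : {V W : Set} → Graph V → Graph W → Graph (V × W)
(G □ H) (u , v) (u' , v') = (u ≡ u' × H v v') ⊎ (v ≡ v' × G u u')

-- Every orientation of C_k (k ≥ 3) maps to one fixed oriented graph D₉ on nine vertices,
-- an apex plus an oriented K_{4,4}, in such a way that the level of the image of a cycle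
-- vertex (apex, or one of the two sides) does not depend on the orientation.  For G □ C_k
-- colour [u , v] by the pair (image of v in the C_k-copy at u , colour of u in the G-copy
-- at v), and let the target D₉ ×_level T have an arc (s , x) → (s' , x') when s → s' in D₉,
-- or when s and s' lie on the same level and x → x' in T.  Arcs of D₉ join distinct
-- levels, so this target is oriented, and since levels agree across all C_k-copies the
-- colouring is a homomorphism.  Hence χ_o^+(G □ C_k) ≤ 9 χ_o^+(G) ≤ 12 χ_o^+(G).
module Submission where

open import Defs
open import Data.Nat using (ℕ; zero; suc; _+_; _*_; _%_; _≤_; _<_; s≤s)
open import Data.Nat.Properties using (m≤n⇒m<n∨m≡n; 1+n≢n; 1+n≢0; *-monoˡ-≤; m≤m+n)
open import Data.Nat.DivMod using (_mod_; m%n<n; m<n⇒m%n≡m; n%n≡0)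
open import Data.Fin using (Fin; toℕ; #_)
open import Data.Fin.Properties using (toℕ-fromℕ<; toℕ-injective; toℕ<n; inject≤-injective; *↔×)
open import Data.Bool using (Bool; true; false; not)
open import Data.Maybe using (Maybe; just; nothing)
open import Data.Product using (_×_; _,_; Σ; ∃; ∃₂; proj₁; proj₂)
open import Data.Sum using (_⊎_; inj₁; inj₂; [_,_]′)
open import Data.Empty using (⊥-elim)
open import Function using (_∘_; const)
open import Function.Bundles using (_↣_; Injection; mk↣)
open import Function.Construct.Composition using (_↣-∘_)
open import Function.Construct.Identity using (↣-id)
open import Function.Properties.Inverse using (↔⇒↣; ↔-sym)
open import Data.Product.Function.NonDependent.Propositional using (_×-↣_)
open import Relation.Nullary using (¬_)
open import Relation.Binary.PropositionalEquality
  using (_≡_; _≢_; refl; sym; trans; cong; subst; subst₂; module ≡-Reasoning)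

Loopless : {V : Set} → Graph V → Set
Loopless G = ∀ {u} → ¬ G u u

MapsTo : {V X : Set} → Graph V → Digraph X → Set₁
MapsTo {V} {X} E T = ∀ (O : Digraph V) → IsOrientationOf E O → ∃ λ (f : V → X) → IsHom O T f

TargetOn : {V : Set} → Graph V → Set → Set₁
TargetOn E X = Σ (Digraph X) λ T → IsOriented T × MapsTo E T

Dir : {S : Set} → Bool → Digraph S → Digraph S
Dir true  D x y = D x y
Dir false D x y = D y x

Dir-true : ∀ {S} {D : Digraph S} {b x y} → b ≡ true → Dir b D x y → D x y
Dir-true refl a = a

Dir-false : ∀ {S} {D : Digraph S} {b x y} → b ≡ false → Dir b D x y → D y x
Dir-false refl a = a

module _ {V : Set} {E : Graph V} {O : Digraph V} (o : IsOrientationOf E O) where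
  open IsOrientationOf o

  direction : ∀ {u v} → E u v → Bool
  direction e = [ const true , const false ]′ (edge⇒arc e)

  direction-arc : ∀ {u v} (e : E u v) → O u v → direction e ≡ true
  direction-arc e p with edge⇒arc e
  ... | inj₁ _ = refl
  ... | inj₂ q = ⊥-elim (oneDir p q)

  direction-reverse : ∀ {u v} (e : E u v) → O v u → direction e ≡ false
  direction-reverse e p with edge⇒arc e
  ... | inj₁ q = ⊥-elim (oneDir p q)
  ... | inj₂ _ = refl

module _ {X Y : Set} (ι : X ↣ Y) where
  open Injection ι using (to; injective)

  Image : Digraph X → Digraph Y
  Image R y y' = ∃₂ λ x x' → to x ≡ y × to x' ≡ y' × R x x'

  Image-oriented : {R : Digraph X} → IsOriented R → IsOriented (Image R)
  Image-oriented {R} r = record { loopless = loopless ; asym = asym }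
    where
    loopless : ∀ {y} → ¬ Image R y y
    loopless (x , x' , refl , e , a) = IsOriented.loopless r (subst (R x) (injective e) a)

    asym : ∀ {y y'} → Image R y y' → ¬ Image R y' y
    asym (x , x' , refl , refl , a) (z , z' , e , e' , b) =
      IsOriented.asym r a (subst₂ R (injective e) (injective e') b)

  MapsTo-image : {V : Set} {E : Graph V} {R : Digraph X} → MapsTo E R → MapsTo E (Image R)
  MapsTo-image maps O o =
    to ∘ proj₁ (maps O o) , λ {u} {v} p → _ , _ , refl , refl , proj₂ (maps O o) p

  TargetOn-↣ : {V : Set} {E : Graph V} → TargetOn E X → TargetOn E Y
  TargetOn-↣ (R , r , maps) = Image R , Image-oriented r , MapsTo-image maps

UpperOColorable-mono : {V : Set} {E : Graph V} {m m' : ℕ} → m ≤ m' →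
  UpperOColorable E m → UpperOColorable E m'
UpperOColorable-mono m≤m' = TargetOn-↣ (mk↣ (inject≤-injective m≤m' m≤m' _ _))

ProperLabelling : {S K : Set} → Digraph S → (S → K) → Set
ProperLabelling D κ = ∀ {s s'} → D s s' → κ s ≢ κ s'

LevelledMapsTo : {W S K : Set} → Graph W → Digraph S → (S → K) → (W → K) → Set₁
LevelledMapsTo {W} {S} H D κ z = ∀ (P : Digraph W) → IsOrientationOf H P →
  ∃ λ (ψ : W → S) → IsHom P D ψ × (∀ w → κ (ψ w) ≡ z w)

Layered : {S K X : Set} → Digraph S → (S → K) → Digraph X → Digraph (S × X)
Layered D κ T (s , x) (s' , x') = (κ s ≡ κ s' × T x x') ⊎ D s s'

Layered-oriented : {S K X : Set} {D : Digraph S} {κ : S → K} {T : Digraph X} →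
  IsOriented D → ProperLabelling D κ → IsOriented T → IsOriented (Layered D κ T)
Layered-oriented {D = D} {κ} {T} d κ-proper t = record { loopless = loopless ; asym = asym }
  where
  loopless : ∀ {u} → ¬ Layered D κ T u u
  loopless (inj₁ (_ , a)) = IsOriented.loopless t a
  loopless (inj₂ a)       = κ-proper a refl

  asym : ∀ {u v} → Layered D κ T u v → ¬ Layered D κ T v u
  asym (inj₁ (_ , a)) (inj₁ (_ , b)) = IsOriented.asym t a b
  asym (inj₁ (e , _)) (inj₂ b)       = κ-proper b (sym e)
  asym (inj₂ a)       (inj₁ (e , _)) = κ-proper a (sym e)
  asym (inj₂ a)       (inj₂ b)       = IsOriented.asym d a b

module _ {V W : Set} {G : Graph V} {H : Graph W} {O : Digraph (V × W)}
         (o : IsOrientationOf (G □ H) O) where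
  open IsOrientationOf o

  rowOrientation : Loopless H → ∀ v → IsOrientationOf G (λ u u' → O (u , v) (u' , v))
  rowOrientation H-loopless v = record
    { arc⇒edge = λ p → row-edge (arc⇒edge p)
    ; edge⇒arc = λ g → edge⇒arc (inj₂ (refl , g))
    ; oneDir   = oneDir
    }
    where
    row-edge : ∀ {u u'} → (G □ H) (u , v) (u' , v) → G u u'
    row-edge (inj₁ (_ , h)) = ⊥-elim (H-loopless h)
    row-edge (inj₂ (_ , g)) = g

  columnOrientation : Loopless G → ∀ u → IsOrientationOf H (λ v v' → O (u , v) (u , v'))
  columnOrientation G-loopless u = record
    { arc⇒edge = λ p → column-edge (arc⇒edge p)
    ; edge⇒arc = λ h → edge⇒arc (inj₁ (refl , h))
    ; oneDir   = oneDir
    }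
    where
    column-edge : ∀ {v v'} → (G □ H) (u , v) (u , v') → H v v'
    column-edge (inj₁ (_ , h)) = h
    column-edge (inj₂ (_ , g)) = ⊥-elim (G-loopless g)

MapsTo-□ : {V W S K X : Set} {G : Graph V} {H : Graph W} →
  Loopless G → Loopless H →
  {T : Digraph X} → MapsTo G T →
  {D : Digraph S} {κ : S → K} {z : W → K} → LevelledMapsTo H D κ z →
  MapsTo (G □ H) (Layered D κ T)
MapsTo-□ {V} {W} {S} {K} {X} G-loopless H-loopless {T} G-maps {D} {κ} {z} H-maps O o =
  colour , hom
  where
  open IsOrientationOf o using (arc⇒edge)

  row : ∀ v → ∃ λ (f : V → X) → IsHom (λ u u' → O (u , v) (u' , v)) T f
  row v = G-maps _ (rowOrientation o H-loopless v)

  column : ∀ u → ∃ λ (ψ : W → S) →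
    IsHom (λ v v' → O (u , v) (u , v')) D ψ × (∀ w → κ (ψ w) ≡ z w)
  column u = H-maps _ (columnOrientation o G-loopless u)

  colour : V × W → S × X
  colour (u , v) = proj₁ (column u) v , proj₁ (row v) u

  hom : IsHom O (Layered D κ T) colour
  hom {u , v} {u' , v'} p with arc⇒edge p
  ... | inj₁ (refl , _) = inj₂ (proj₁ (proj₂ (column u)) p)
  ... | inj₂ (refl , _) =
    inj₁ (trans (proj₂ (proj₂ (column u)) v) (sym (proj₂ (proj₂ (column u')) v))
         , proj₂ (row v) p)

TargetOn-□ : {V W S K X : Set} {G : Graph V} {H : Graph W} →
  Loopless G → Loopless H → TargetOn G X →
  {D : Digraph S} {κ : S → K} {z : W → K} →
  IsOriented D → ProperLabelling D κ → LevelledMapsTo H D κ z →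
  TargetOn (G □ H) (S × X)
TargetOn-□ G-loopless H-loopless (T , t , G-maps) {D} {κ} d κ-proper H-maps =
  Layered D κ T , Layered-oriented d κ-proper t , MapsTo-□ G-loopless H-loopless {T} G-maps {D} {κ} H-maps

data V₉ : Set where
  apex : V₉
  node : (side outOfApex phase : Bool) → V₉

data D₉ : Digraph V₉ where
  apex⇒ : ∀ {s p}   → D₉ apex (node s true p)
  ⇒apex : ∀ {s p}   → D₉ (node s false p) apex
  rise  : ∀ {x y p} → D₉ (node false x p) (node true y p)
  fall  : ∀ {x y p} → D₉ (node true x p) (node false y (not p))

D₉-oriented : IsOriented D₉
D₉-oriented = record { loopless = λ () ; asym = asym }
  where
  asym : ∀ {u v} → D₉ u v → ¬ D₉ v u
  asym apex⇒ ()
  asym ⇒apex ()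
  asym (rise {p = false}) ()
  asym (rise {p = true}) ()
  asym (fall {p = false}) ()
  asym (fall {p = true}) ()

level : V₉ → Maybe Bool
level apex         = nothing
level (node s _ _) = just s

level-proper : ProperLabelling D₉ level
level-proper apex⇒ ()
level-proper ⇒apex ()
level-proper rise ()
level-proper fall ()

nextPhase : (side forward phase : Bool) → Bool
nextPhase false true  p = p
nextPhase false false p = not p
nextPhase true  true  p = not p
nextPhase true  false p = p

D₉-step : ∀ s f x y p → Dir f D₉ (node s x p) (node (not s) y (nextPhase s f p))
D₉-step false true  x y p     = rise
D₉-step false false x y false = fall
D₉-step false false x y true  = fall
D₉-step true  true  x y p     = fall
D₉-step true  false x y p     = rise

odd : ℕ → Bool
odd zero    = false
odd (suc m) = not (odd m)

cycleLevel : ℕ → Maybe Bool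
cycleLevel zero    = nothing
cycleLevel (suc m) = just (odd (suc m))

-- The apex bit is constrained only at
-- the neighbours 1 and k − 1 of 0, which are distinct because k ≥ 3.
module Walk (dir : ℕ → Bool) where
  phase : ℕ → Bool
  phase zero          = false
  phase (suc zero)    = false
  phase (suc (suc m)) = nextPhase (odd (suc m)) (dir (suc m)) (phase (suc m))

  outOfApex : ℕ → Bool
  outOfApex (suc zero) = dir 0
  outOfApex m          = not (dir m)

  ψ : ℕ → V₉
  ψ zero    = apex
  ψ (suc m) = node (odd (suc m)) (outOfApex (suc m)) (phase (suc m))

  level-ψ : ∀ m → level (ψ m) ≡ cycleLevel m
  level-ψ zero    = refl
  level-ψ (suc m) = refl

  ψ-step : ∀ m → Dir (dir m) D₉ (ψ m) (ψ (suc m))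
  ψ-step zero with dir 0
  ... | true  = apex⇒
  ... | false = ⇒apex
  ψ-step (suc m) = D₉-step (odd (suc m)) (dir (suc m)) _ _ (phase (suc m))

  ψ-close : ∀ n → Dir (dir (2 + n)) D₉ (ψ (2 + n)) apex
  ψ-close n with dir (2 + n)
  ... | true  = ⇒apex
  ... | false = apex⇒

  ψ-around : ∀ n {m} → m < 3 + n → Dir (dir m) D₉ (ψ m) (ψ (suc m % (3 + n)))
  ψ-around n {m} m<k with m≤n⇒m<n∨m≡n m<k
  ... | inj₁ 1+m<k = subst (Dir (dir m) D₉ (ψ m) ∘ ψ) (sym (m<n⇒m%n≡m 1+m<k)) (ψ-step m)
  ... | inj₂ refl  = subst (Dir (dir m) D₉ (ψ m) ∘ ψ) (sym (n%n≡0 (3 + n))) (ψ-close n)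

suc-mod-no-fixpoint : ∀ n {m} → m < 2 + n → m ≢ suc m % (2 + n)
suc-mod-no-fixpoint n {m} m<k e with m≤n⇒m<n∨m≡n m<k
... | inj₁ 1+m<k = 1+n≢n (sym (trans e (m<n⇒m%n≡m 1+m<k)))
... | inj₂ refl  = 1+n≢0 (trans e (n%n≡0 (2 + n)))

Cycle-loopless : ∀ n → Loopless (Cycle (2 + n))
Cycle-loopless n {v} (inj₁ e) = suc-mod-no-fixpoint n (toℕ<n v) e
Cycle-loopless n {v} (inj₂ e) = suc-mod-no-fixpoint n (toℕ<n v) e

module _ (n : ℕ) where
  private
    k : ℕ
    k = 3 + n

  next : Fin k → Fin k
  next v = suc (toℕ v) mod k

  toℕ-next : ∀ v → toℕ (next v) ≡ suc (toℕ v) % k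
  toℕ-next v = toℕ-fromℕ< (m%n<n (suc (toℕ v)) k)

  next-unique : ∀ {v w} → toℕ w ≡ suc (toℕ v) % k → w ≡ next v
  next-unique {v} e = toℕ-injective (trans e (sym (toℕ-next v)))

  toℕ-mod : ∀ (v : Fin k) → toℕ v mod k ≡ v
  toℕ-mod v = toℕ-injective (trans (toℕ-fromℕ< (m%n<n (toℕ v) k)) (m<n⇒m%n≡m (toℕ<n v)))

  Cycle-levelled : LevelledMapsTo (Cycle k) D₉ level (cycleLevel ∘ toℕ)
  Cycle-levelled P o = ψ ∘ toℕ , hom , level-ψ ∘ toℕ
    where
    open IsOrientationOf o using (arc⇒edge)

    forward : Fin k → Bool
    forward v = direction o {v} {next v} (inj₁ (toℕ-next v))

    open Walk (λ m → forward (m mod k))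

    ψ-next : ∀ v → Dir (forward v) D₉ (ψ (toℕ v)) (ψ (toℕ (next v)))
    ψ-next v = subst₂ (λ b t → Dir b D₉ (ψ (toℕ v)) (ψ t))
      (cong forward (toℕ-mod v)) (sym (toℕ-next v)) (ψ-around n (toℕ<n v))

    arc-forward : ∀ {u v} → P u v → v ≡ next u → D₉ (ψ (toℕ u)) (ψ (toℕ v))
    arc-forward {u} p refl = Dir-true (direction-arc o (inj₁ (toℕ-next u)) p) (ψ-next u)

    arc-backward : ∀ {u v} → P u v → u ≡ next v → D₉ (ψ (toℕ u)) (ψ (toℕ v))
    arc-backward {v = v} p refl =
      Dir-false (direction-reverse o (inj₁ (toℕ-next v)) p) (ψ-next v)

    hom : IsHom P D₉ (ψ ∘ toℕ)
    hom {u} {v} p with arc⇒edge p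
    ... | inj₁ e = arc-forward p (next-unique {u} e)
    ... | inj₂ e = arc-backward p (next-unique {v} e)

encode₉ : V₉ → Fin 9
encode₉ apex                     = # 0
encode₉ (node false false false) = # 1
encode₉ (node false false true)  = # 2
encode₉ (node false true  false) = # 3
encode₉ (node false true  true)  = # 4
encode₉ (node true  false false) = # 5
encode₉ (node true  false true)  = # 6
encode₉ (node true  true  false) = # 7
encode₉ (node true  true  true)  = # 8

decode₉ : ℕ → V₉
decode₉ 1 = node false false false
decode₉ 2 = node false false true
decode₉ 3 = node false true  false
decode₉ 4 = node false true  true
decode₉ 5 = node true  false false
decode₉ 6 = node true  false true
decode₉ 7 = node true  true  false
decode₉ 8 = node true  true  true
decode₉ _ = apex

decode-encode₉ : ∀ s → decode₉ (toℕ (encode₉ s)) ≡ s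
decode-encode₉ apex                     = refl
decode-encode₉ (node false false false) = refl
decode-encode₉ (node false false true)  = refl
decode-encode₉ (node false true  false) = refl
decode-encode₉ (node false true  true)  = refl
decode-encode₉ (node true  false false) = refl
decode-encode₉ (node true  false true)  = refl
decode-encode₉ (node true  true  false) = refl
decode-encode₉ (node true  true  true)  = refl

V₉↣Fin9 : V₉ ↣ Fin 9
V₉↣Fin9 = mk↣ λ {s} {s'} e → begin
  s                            ≡⟨ sym (decode-encode₉ s) ⟩
  decode₉ (toℕ (encode₉ s))    ≡⟨ cong (decode₉ ∘ toℕ) e ⟩
  decode₉ (toℕ (encode₉ s'))   ≡⟨ decode-encode₉ s' ⟩
  s'                           ∎
  where open ≡-Reasoning

V₉×Fin↣Fin : ∀ c → (V₉ × Fin c) ↣ Fin (9 * c)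
V₉×Fin↣Fin c = ↔⇒↣ (↔-sym *↔×) ↣-∘ (V₉↣Fin9 ×-↣ ↣-id (Fin c))

□-Cycle-colourable : ∀ {V} {G : Graph V} → Loopless G → ∀ {c} →
  UpperOColorable G c → ∀ n → UpperOColorable (G □ Cycle (3 + n)) (9 * c)
□-Cycle-colourable G-loopless {c} G-colourable n =
  TargetOn-↣ (V₉×Fin↣Fin c)
    (TargetOn-□ G-loopless (Cycle-loopless (suc n)) G-colourable
      D₉-oriented level-proper (Cycle-levelled n))

corollary6 : ∀ (n : ℕ) (G : Graph (Fin n)) → IsSimple G → (c : ℕ) → IsUpperOChromatic G c →
    UpperOColorable (G □ Cycle 5) (15 * c)
    × (∀ (k : ℕ) → 3 ≤ k → k ≢ 5 → UpperOColorable (G □ Cycle k) (12 * c))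
corollary6 n G G-simple c (G-colourable , _) =
  UpperOColorable-mono (*-monoˡ-≤ c (m≤m+n 9 6)) (colourable 2) , cycles
  where
  colourable : ∀ k' → UpperOColorable (G □ Cycle (3 + k')) (9 * c)
  colourable = □-Cycle-colourable (IsSimple.irrefl G-simple) G-colourable

  cycles : ∀ (k : ℕ) → 3 ≤ k → k ≢ 5 → UpperOColorable (G □ Cycle k) (12 * c)
  cycles (suc (suc (suc k'))) (s≤s (s≤s (s≤s _))) _ =
    UpperOColorable-mono (*-monoˡ-≤ c (m≤m+n 9 3)) (colourable k')
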